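{- Let $T$ be a proper binary tree with root $v_t$ and saturated vertices $u$ and $w$ such that $R_T(u)=R_T(w)$. Let $u_1,w_1$ be the siblings and $u_0,w_0$ the parents of $u,w$ respectively, and assume that $u_0$ is an ancestor of $w_0$. Suppose $R_T(w_1)\le R_T(u)-1$. Let $T^*=T-uu_0-w_1w_0+uw_0+w_1u_0$ (i.e. the subtrees $T(u)$ and $T(w_1)$ are exchanged; $T^*$ has the same root as $T$). Suppose that either $u_0$ is the root of $T$, or $u_0\ne v_t$, $u_0v_1\cdots v_t$ is the path from $u_0$ to the root, and $R_T(v_1)\le 2+R_T(w_1)$. Then $R(T^*)\ge R(T)$.
   Context: All trees are rooted; $T(v)$ is the subtree induced by $v$ and its descendants; a leaf is a vertex with no children. The rank $R_T(v)$ is the minimum distance from $v$ to a leaf of $T(v)$, and the security is $R(T)=\sum_{v}R_T(v)$. A proper binary tree is an unordered rooted tree in which every non-leaf vertex has exactly two children. A complete binary tree is a proper binary tree whose leaves are all at the same distance from its root. A vertex $v$ of a proper binary tree $T$ is saturated if $T(v)$ is a complete binary tree but $T(x)$ is not a complete binary tree for any proper ancestor $x$ of $v$. -}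

module Defs where

open import Data.Nat using (ℕ; zero; suc; _+_; _⊓_)
open import Data.Bool using (Bool; true; false; not)
open import Data.List using (List; []; _∷_; _++_; _∷ʳ_)
open import Data.Product using (∃; _×_; _,_)
open import Relation.Binary.PropositionalEquality using (_≡_)
open import Relation.Nullary using (¬_)

-- The representation is ordered (left/right), but all notions below are
-- invariant under swapping children, so this models unordered trees.
data Tree : Set where
  leaf : Tree
  node : Tree → Tree → Tree

-- A vertex of a tree is addressed by the path from the root:
-- false = go to left child, true = go to right child.  Root = [].
Addr : Set
Addr = List Bool

data Valid : Tree → Addr → Set where
  here  : ∀ {t} → Valid t []
  left  : ∀ {l r p} → Valid l p → Valid (node l r) (false ∷ p)
  right : ∀ {l r p} → Valid r p → Valid (node l r) (true ∷ p)

-- The subtree T(v) (junk value leaf on invalid addresses).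
sub : Tree → Addr → Tree
sub t [] = t
sub leaf (_ ∷ _) = leaf
sub (node l r) (false ∷ p) = sub l p
sub (node l r) (true ∷ p) = sub r p

graft : Tree → Addr → Tree → Tree
graft _ [] s = s
graft leaf (_ ∷ _) s = leaf
graft (node l r) (false ∷ p) s = node (graft l p s) r
graft (node l r) (true ∷ p) s = node l (graft r p s)

rank : Tree → ℕ
rank leaf = 0
rank (node l r) = suc (rank l ⊓ rank r)

R : Tree → Addr → ℕ
R t v = rank (sub t v)

security : Tree → ℕ
security leaf = 0
security (node l r) = rank (node l r) + security l + security r

data AllLeavesAt : ℕ → Tree → Set where
  lf : AllLeavesAt 0 leaf
  nd : ∀ {n l r} → AllLeavesAt n l → AllLeavesAt n r → AllLeavesAt (suc n) (node l r)

IsComplete : Tree → Set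
IsComplete t = ∃ λ n → AllLeavesAt n t

ProperAncestor : Addr → Addr → Set
ProperAncestor x v = ∃ λ b → ∃ λ y → v ≡ x ++ (b ∷ y)

Ancestor : Addr → Addr → Set
Ancestor x v = ∃ λ y → v ≡ x ++ y

Saturated : Tree → Addr → Set
Saturated t v = Valid t v × IsComplete (sub t v)
              × (∀ x → ProperAncestor x v → ¬ IsComplete (sub t x))

exchange : Tree → Addr → Addr → Tree
exchange t a b = graft (graft t a (sub t b)) b (sub t a)

{-# OPTIONS --safe #-}

-- Let h = R(u) = R(w) and ρ = R(w₁) < h.  The saturated vertex w cannot lie below the complete
-- T(u), and if w₀ = u₀ the exchange merely swaps the children of u₀; otherwise w lies in T(u₁),
-- u₁ the sibling of u.  Putting T(u) in place of T(w₁) raises the rank of w₀ from ρ + 1 to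
-- h + 1 and lowers no rank on the way up to u₁, so the security of T(u₁) grows by at least
-- (h + security T(u)) − (ρ + security T(w₁)).  At u₀, where T(w₁) takes the place of T(u), the
-- rank drops by at most h − ρ, which that gain pays for.  The new rank of u₀ is still at least
-- min(ρ + 1, old rank), and since R(v₁) ≤ ρ + 2 the rank of v₁, and so of every vertex above it,
-- does not drop.
module Submission where

open import Defs
open import Data.Nat using (ℕ; suc; _+_; _≤_; _<_; _⊓_; z≤n; s≤s)
open import Data.Nat.Properties
open import Data.Nat.Tactic.RingSolver using (solve-∀)
open import Data.Bool using (Bool; true; false; not)
open import Data.List using ([]; _∷_; _++_; _∷ʳ_)
open import Data.List.Properties using (++-assoc; ++-identityʳ)
open import Data.Product using (∃; _×_; _,_)
open import Data.Sum using (_⊎_; inj₁; inj₂)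
open import Data.Empty using (⊥-elim)
open import Relation.Binary.PropositionalEquality
  using (_≡_; refl; sym; trans; cong; cong₂; subst₂; module ≡-Reasoning)

infix 4 _≼_

_≼_ : Tree → Tree → Set
s ≼ t = rank s ≤ rank t × security s ≤ security t

sub-leaf : ∀ p → sub leaf p ≡ leaf
sub-leaf [] = refl
sub-leaf (_ ∷ _) = refl

sub-++ : ∀ t p q → sub t (p ++ q) ≡ sub (sub t p) q
sub-++ t [] q = refl
sub-++ leaf (_ ∷ p) q = sym (sub-leaf q)
sub-++ (node l r) (false ∷ p) q = sub-++ l p q
sub-++ (node l r) (true ∷ p) q = sub-++ r p q

graft-++ : ∀ t p q X → graft t (p ++ q) X ≡ graft t p (graft (sub t p) q X)
graft-++ t [] q X = refl
graft-++ leaf (_ ∷ p) q X = refl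
graft-++ (node l r) (false ∷ p) q X = cong (λ l′ → node l′ r) (graft-++ l p q X)
graft-++ (node l r) (true ∷ p) q X = cong (node l) (graft-++ r p q X)

exchange-++ : ∀ t p a b → exchange t (p ++ a) (p ++ b) ≡ graft t p (exchange (sub t p) a b)
exchange-++ t [] a b = refl
exchange-++ leaf (_ ∷ p) a b = refl
exchange-++ (node l r) (false ∷ p) a b = cong (λ l′ → node l′ r) (exchange-++ l p a b)
exchange-++ (node l r) (true ∷ p) a b = cong (node l) (exchange-++ r p a b)

sub-++-∷ʳ : ∀ t p q b → sub t ((p ++ q) ∷ʳ b) ≡ sub (sub t p) (q ∷ʳ b)
sub-++-∷ʳ t p q b = trans (cong (sub t) (++-assoc p q (b ∷ []))) (sub-++ t p (q ∷ʳ b))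

exchange-++-∷ʳ : ∀ t p a q b →
  exchange t (p ∷ʳ a) ((p ++ q) ∷ʳ b) ≡ graft t p (exchange (sub t p) (a ∷ []) (q ∷ʳ b))
exchange-++-∷ʳ t p a q b =
  trans (cong (exchange t (p ∷ʳ a)) (++-assoc p q (b ∷ []))) (exchange-++ t p (a ∷ []) (q ∷ʳ b))

∷ʳ-properAncestor : ∀ p b y c → ProperAncestor (p ∷ʳ b) ((p ++ (b ∷ y)) ∷ʳ c)
∷ʳ-properAncestor p b [] c = c , [] , refl
∷ʳ-properAncestor p b (d ∷ y) c = d , y ∷ʳ c ,
  trans (++-assoc p (b ∷ d ∷ y) (c ∷ [])) (sym (++-assoc p (b ∷ []) (d ∷ y ∷ʳ c)))

rank-node-comm : ∀ l r → rank (node l r) ≡ rank (node r l)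
rank-node-comm l r = cong suc (⊓-comm (rank l) (rank r))

security-node-comm : ∀ l r → security (node l r) ≡ security (node r l)
security-node-comm l r = begin
  rank (node l r) + security l + security r    ≡⟨ +-assoc (rank (node l r)) (security l) (security r) ⟩
  rank (node l r) + (security l + security r)  ≡⟨ cong₂ _+_ (rank-node-comm l r) (+-comm (security l) (security r)) ⟩
  rank (node r l) + (security r + security l)  ≡⟨ sym (+-assoc (rank (node r l)) (security r) (security l)) ⟩
  rank (node r l) + security r + security l    ∎
  where open ≡-Reasoning

rank-graft-mono : ∀ t p X → R t p ≤ rank X → rank t ≤ rank (graft t p X)
rank-graft-mono t [] X rank≤ = rank≤
rank-graft-mono leaf (_ ∷ p) X rank≤ = ≤-refl
rank-graft-mono (node l r) (false ∷ p) X rank≤ = s≤s (⊓-monoˡ-≤ (rank r) (rank-graft-mono l p X rank≤))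
rank-graft-mono (node l r) (true ∷ p) X rank≤ = s≤s (⊓-monoʳ-≤ (rank l) (rank-graft-mono r p X rank≤))

security-node-monoˡ : ∀ {l l′ r} → rank (node l r) ≤ rank (node l′ r) →
  security l ≤ security l′ → security (node l r) ≤ security (node l′ r)
security-node-monoˡ {r = r} rank≤ sec≤ = +-monoˡ-≤ (security r) (+-mono-≤ rank≤ sec≤)

security-node-monoʳ : ∀ {l r r′} → rank (node l r) ≤ rank (node l r′) →
  security r ≤ security r′ → security (node l r) ≤ security (node l r′)
security-node-monoʳ {l} rank≤ sec≤ = +-mono-≤ (+-monoˡ-≤ (security l) rank≤) sec≤

security-graft-mono : ∀ t p X → sub t p ≼ X → security t ≤ security (graft t p X)
security-graft-mono t [] X (_ , sec≤) = sec≤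
security-graft-mono leaf (_ ∷ p) X _ = ≤-refl
security-graft-mono (node l r) (false ∷ p) X sub≼X@(rank≤ , _) =
  security-node-monoˡ (rank-graft-mono (node l r) (false ∷ p) X rank≤) (security-graft-mono l p X sub≼X)
security-graft-mono (node l r) (true ∷ p) X sub≼X@(rank≤ , _) =
  security-node-monoʳ (rank-graft-mono (node l r) (true ∷ p) X rank≤) (security-graft-mono r p X sub≼X)

security-node-+-monoʳ : ∀ {l r r′ k m} → rank (node l r) ≤ rank (node l r′) →
  security r + k ≤ security r′ + m → security (node l r) + k ≤ security (node l r′) + m
security-node-+-monoʳ {l} {r} {r′} {k} {m} rank≤ sec≤ = begin
  rank (node l r) + security l + security r + k      ≡⟨ +-assoc (rank (node l r) + security l) (security r) k ⟩
  rank (node l r) + security l + (security r + k)    ≤⟨ +-mono-≤ (+-monoˡ-≤ (security l) rank≤) sec≤ ⟩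
  rank (node l r′) + security l + (security r′ + m)  ≡⟨ sym (+-assoc (rank (node l r′) + security l) (security r′) m) ⟩
  rank (node l r′) + security l + security r′ + m    ∎
  where open ≤-Reasoning

security-node-+-monoˡ : ∀ {l l′ r k m} → rank (node l r) ≤ rank (node l′ r) →
  security l + k ≤ security l′ + m → security (node l r) + k ≤ security (node l′ r) + m
security-node-+-monoˡ {l} {l′} {r} {k} {m} rank≤ sec≤ =
  subst₂ _≤_ (cong (_+ k) (security-node-comm r l)) (cong (_+ m) (security-node-comm r l′))
    (security-node-+-monoʳ (subst₂ _≤_ (rank-node-comm l r) (rank-node-comm l′ r) rank≤) sec≤)

-- Validity is needed: at an invalid address graft changes nothing, whatever k and m are.
security-graft-+-mono : ∀ t p X {k m} → Valid t p → R t p ≤ rank X →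
  security (sub t p) + k ≤ security X + m → security t + k ≤ security (graft t p X) + m
security-graft-+-mono t [] X here rank≤ sec≤ = sec≤
security-graft-+-mono (node l r) (false ∷ p) X (left valid) rank≤ sec≤ =
  security-node-+-monoˡ (rank-graft-mono (node l r) (false ∷ p) X rank≤)
    (security-graft-+-mono l p X valid rank≤ sec≤)
security-graft-+-mono (node l r) (true ∷ p) X (right valid) rank≤ sec≤ =
  security-node-+-monoʳ (rank-graft-mono (node l r) (true ∷ p) X rank≤)
    (security-graft-+-mono r p X valid rank≤ sec≤)

0<R-++⇒Valid : ∀ t p q → 0 < R t (p ++ q) → Valid t p
0<R-++⇒Valid t [] q _ = here
0<R-++⇒Valid leaf (_ ∷ p) q ()
0<R-++⇒Valid (node l r) (false ∷ p) q 0<R = left (0<R-++⇒Valid l p q 0<R)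
0<R-++⇒Valid (node l r) (true ∷ p) q 0<R = right (0<R-++⇒Valid r p q 0<R)

security-node-replaceʳ : ∀ W B X → rank B ≤ rank X → rank X ≤ rank W →
  rank (node W B) ≤ rank (node W X)
  × security (node W B) + (rank X + security X) ≡ security (node W X) + (rank B + security B)
security-node-replaceʳ W B X B≤X X≤W
  rewrite m≥n⇒m⊓n≡n (≤-trans B≤X X≤W) | m≥n⇒m⊓n≡n X≤W =
  s≤s B≤X , shift (rank B) (rank X) (security W) (security B) (security X)
  where
  shift : ∀ ρ x sW sB sX → suc ρ + sW + sB + (x + sX) ≡ suc x + sW + sX + (ρ + sB)
  shift = solve-∀

security-graft-child : ∀ P b X → R P (not b ∷ []) < rank X → rank X ≤ R P (b ∷ []) →
  rank P ≤ rank (graft P (not b ∷ []) X)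
  × security P + (rank X + security X)
    ≡ security (graft P (not b ∷ []) X) + (R P (not b ∷ []) + security (sub P (not b ∷ [])))
security-graft-child leaf b X B<X X≤W = ⊥-elim (<-irrefl refl (≤-trans B<X X≤W))
security-graft-child (node W B) false X B<X X≤W = security-node-replaceʳ W B X (<⇒≤ B<X) X≤W
security-graft-child (node B W) true X B<X X≤W =
  let rank≤ , sec≡ = security-node-replaceʳ W B X (<⇒≤ B<X) X≤W
  in subst₂ _≤_ (rank-node-comm W B) (rank-node-comm W X) rank≤ ,
     trans (cong (_+ (rank X + security X)) (security-node-comm B W))
       (trans sec≡ (cong (_+ (rank B + security B)) (security-node-comm W X)))

security-graft-beside : ∀ t y b X → R t (y ∷ʳ not b) < rank X → rank X ≤ R t (y ∷ʳ b) →
  rank t ≤ rank (graft t (y ∷ʳ not b) X)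
  × security t + (rank X + security X)
    ≤ security (graft t (y ∷ʳ not b) X) + (R t (y ∷ʳ not b) + security (sub t (y ∷ʳ not b)))
security-graft-beside t y b X B<X X≤W
  with valid ← 0<R-++⇒Valid t y (b ∷ []) (<-≤-trans (≤-<-trans z≤n B<X) X≤W)
  rewrite graft-++ t y (not b ∷ []) X | sub-++ t y (not b ∷ []) | sub-++ t y (b ∷ [])
  = let rank≤ , sec≡ = security-graft-child (sub t y) b X B<X X≤W
    in rank-graft-mono t y _ rank≤ , security-graft-+-mono t y _ valid rank≤ (≤-reflexive sec≡)

m⊓n+o≤o⊓p+m : ∀ m n o p → o ≤ m → n ≤ p → m ⊓ n + o ≤ o ⊓ p + m
m⊓n+o≤o⊓p+m m n o p o≤m n≤p with ≤-total o p
... | inj₁ o≤p rewrite m≤n⇒m⊓n≡m o≤p = ≤-trans (+-monoˡ-≤ o (m⊓n≤m m n)) (≤-reflexive (+-comm m o))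
... | inj₂ p≤o rewrite m≥n⇒m⊓n≡n p≤o = +-mono-≤ (≤-trans (m⊓n≤n m n) n≤p) o≤m

+-exchange-≤ : ∀ x x′ h ρ sU sr sB sr′ → x + ρ ≤ x′ + h →
  sr + (h + sU) ≤ sr′ + (ρ + sB) → x + sU + sr ≤ x′ + sB + sr′
+-exchange-≤ x x′ h ρ sU sr sB sr′ x≤ sr≤ = +-cancelʳ-≤ (h + ρ) _ _ (begin
  x + sU + sr + (h + ρ)        ≡⟨ lhs x ρ sU sr h ⟩
  x + ρ + (sr + (h + sU))      ≤⟨ +-mono-≤ x≤ sr≤ ⟩
  x′ + h + (sr′ + (ρ + sB))    ≡⟨ rhs x′ h ρ sB sr′ ⟩
  x′ + sB + sr′ + (h + ρ)      ∎)
  where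
  open ≤-Reasoning
  lhs : ∀ x ρ sU sr h → x + sU + sr + (h + ρ) ≡ x + ρ + (sr + (h + sU))
  lhs = solve-∀
  rhs : ∀ x′ h ρ sB sr′ → x′ + h + (sr′ + (ρ + sB)) ≡ x′ + sB + sr′ + (h + ρ)
  rhs = solve-∀

-- The root loses at most rank U − rank B (m⊓n+o≤o⊓p+m), which the gain in r pays for.
node-exchange-bounds : ∀ U r B r′ → rank B ≤ rank U → rank r ≤ rank r′ →
  security r + (rank U + security U) ≤ security r′ + (rank B + security B) →
  suc (rank B) ⊓ rank (node U r) ≤ rank (node B r′) × security (node U r) ≤ security (node B r′)
node-exchange-bounds U r B r′ ρ≤h a≤a′ gain =
  s≤s (⊓-monoʳ-≤ ρ (≤-trans (m⊓n≤n h a) a≤a′)) ,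
  +-exchange-≤ (rank (node U r)) (rank (node B r′)) h ρ (security U) (security r) (security B) (security r′)
    (s≤s (m⊓n+o≤o⊓p+m h a ρ a′ ρ≤h a≤a′)) gain
  where
  h = rank U
  a = rank r
  ρ = rank B
  a′ = rank r′

exchange-child-into-sibling-bounds : ∀ S bu y bw →
  R S (bu ∷ []) ≡ R S (not bu ∷ y ∷ʳ bw) → suc (R S (not bu ∷ y ∷ʳ not bw)) ≤ R S (bu ∷ []) →
  suc (R S (not bu ∷ y ∷ʳ not bw)) ⊓ rank S ≤ rank (exchange S (bu ∷ []) (not bu ∷ y ∷ʳ not bw))
  × security S ≤ security (exchange S (bu ∷ []) (not bu ∷ y ∷ʳ not bw))
exchange-child-into-sibling-bounds leaf bu y bw h≡ ()
exchange-child-into-sibling-bounds (node U r) false y bw h≡ ρ<h =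
  let a≤a′ , gain = security-graft-beside r y bw U ρ<h (≤-reflexive h≡)
  in node-exchange-bounds U r (sub r (y ∷ʳ not bw)) (graft r (y ∷ʳ not bw) U) (<⇒≤ ρ<h) a≤a′ gain
exchange-child-into-sibling-bounds (node r U) true y bw h≡ ρ<h =
  let a≤a′ , gain = security-graft-beside r y bw U ρ<h (≤-reflexive h≡)
      rank≥ , sec≤ = node-exchange-bounds U r B r′ (<⇒≤ ρ<h) a≤a′ gain
  in subst₂ _≤_ (cong (suc (rank B) ⊓_) (rank-node-comm U r)) (rank-node-comm B r′) rank≥ ,
     subst₂ _≤_ (security-node-comm U r) (security-node-comm B r′) sec≤
  where
  B = sub r (y ∷ʳ not bw)
  r′ = graft r (y ∷ʳ not bw) U

-- If the old child x has rank > ρ + 1, then rank V ≤ ρ + 2 forces its sibling to have rank ≤ ρ + 1,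
-- and the sibling alone then determines rank V.
graft-child-≼ : ∀ V b X ρ → rank V ≤ 2 + ρ → suc ρ ⊓ R V (b ∷ []) ≤ rank X →
  security (sub V (b ∷ [])) ≤ security X → V ≼ graft V (b ∷ []) X
graft-child-≼ leaf b X ρ _ _ _ = ≤-refl , ≤-refl
graft-child-≼ (node x z) false X ρ (s≤s x⊓z≤) X≥ sec≤ = rank≤ , security-node-monoˡ rank≤ sec≤
  where
  rank≤ : rank (node x z) ≤ rank (node X z)
  rank≤ = s≤s (⊓-glb (≤-trans (⊓-glb x⊓z≤ (m⊓n≤m (rank x) (rank z))) X≥) (m⊓n≤n (rank x) (rank z)))
graft-child-≼ (node x z) true X ρ (s≤s x⊓z≤) X≥ sec≤ = rank≤ , security-node-monoʳ rank≤ sec≤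
  where
  rank≤ : rank (node x z) ≤ rank (node x X)
  rank≤ = s≤s (⊓-glb (m⊓n≤m (rank x) (rank z)) (≤-trans (⊓-glb x⊓z≤ (m⊓n≤n (rank x) (rank z))) X≥))

ParentRankAtMost : Tree → Addr → ℕ → Set
ParentRankAtMost T u n = u ≡ [] ⊎ ∃ λ v → ∃ λ b → u ≡ v ∷ʳ b × R T v ≤ n

security-graft-under-low-parent : ∀ T u X ρ → ParentRankAtMost T u (2 + ρ) →
  suc ρ ⊓ R T u ≤ rank X → security (sub T u) ≤ security X → security T ≤ security (graft T u X)
security-graft-under-low-parent T .[] X ρ (inj₁ refl) _ sec≤ = sec≤
security-graft-under-low-parent T .(v ∷ʳ b) X ρ (inj₂ (v , b , refl , V≤)) X≥ sec≤
  rewrite graft-++ T v (b ∷ []) X | sub-++ T v (b ∷ []) =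
  security-graft-mono T v _ (graft-child-≼ (sub T v) b X ρ V≤ X≥ sec≤)

exchange-siblings-≼ : ∀ S b → S ≼ exchange S (b ∷ []) (not b ∷ [])
exchange-siblings-≼ leaf b = ≤-refl , ≤-refl
exchange-siblings-≼ (node l r) false = ≤-reflexive (rank-node-comm l r) , ≤-reflexive (security-node-comm l r)
exchange-siblings-≼ (node l r) true = ≤-reflexive (rank-node-comm l r) , ≤-reflexive (security-node-comm l r)

security-exchange-siblings : ∀ T u b → security T ≤ security (exchange T (u ∷ʳ b) (u ∷ʳ not b))
security-exchange-siblings T u b rewrite exchange-++ T u (b ∷ []) (not b ∷ []) =
  security-graft-mono T u _ (exchange-siblings-≼ (sub T u) b)

security-exchange-in-parent : ∀ T u bu bw → suc (R T (u ∷ʳ not bw)) ≤ R T (u ∷ʳ bu) →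
  security T ≤ security (exchange T (u ∷ʳ bu) (u ∷ʳ not bw))
security-exchange-in-parent T u false false _ = security-exchange-siblings T u false
security-exchange-in-parent T u true true _ = security-exchange-siblings T u true
security-exchange-in-parent T u false true w₁<u = ⊥-elim (<-irrefl refl w₁<u)
security-exchange-in-parent T u true false w₁<u = ⊥-elim (<-irrefl refl w₁<u)

security-exchange-into-sibling-subtree : ∀ T u₀ bu y bw →
  R T (u₀ ∷ʳ bu) ≡ R T ((u₀ ++ (not bu ∷ y)) ∷ʳ bw) →
  suc (R T ((u₀ ++ (not bu ∷ y)) ∷ʳ not bw)) ≤ R T (u₀ ∷ʳ bu) →
  ParentRankAtMost T u₀ (2 + R T ((u₀ ++ (not bu ∷ y)) ∷ʳ not bw)) →
  security T ≤ security (exchange T (u₀ ∷ʳ bu) ((u₀ ++ (not bu ∷ y)) ∷ʳ not bw))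
security-exchange-into-sibling-subtree T u₀ bu y bw h≡ ρ<h parent≤
  rewrite exchange-++-∷ʳ T u₀ bu (not bu ∷ y) (not bw)
        | sub-++-∷ʳ T u₀ (not bu ∷ y) bw | sub-++-∷ʳ T u₀ (not bu ∷ y) (not bw) | sub-++ T u₀ (bu ∷ [])
  = let rank≥ , sec≤ = exchange-child-into-sibling-bounds (sub T u₀) bu y bw h≡ ρ<h
    in security-graft-under-low-parent T u₀ _ _ parent≤ rank≥ sec≤

lemma2p6 : (T : Tree) (u₀ w₀ : Addr) (bu bw : Bool)
    → Saturated T (u₀ ∷ʳ bu)
    → Saturated T (w₀ ∷ʳ bw)
    → R T (u₀ ∷ʳ bu) ≡ R T (w₀ ∷ʳ bw)
    → Ancestor u₀ w₀
    → suc (R T (w₀ ∷ʳ not bw)) ≤ R T (u₀ ∷ʳ bu)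
    → (u₀ ≡ [] ⊎ ∃ λ v₁ → ∃ λ b → u₀ ≡ v₁ ∷ʳ b × R T v₁ ≤ 2 + R T (w₀ ∷ʳ not bw))
    → security T ≤ security (exchange T (u₀ ∷ʳ bu) (w₀ ∷ʳ not bw))
lemma2p6 T u₀ _ bu bw _ _ _ ([] , refl) w₁<u _
  rewrite ++-identityʳ u₀ = security-exchange-in-parent T u₀ bu bw w₁<u
lemma2p6 T u₀ _ false bw _ _ h≡ (true ∷ y , refl) w₁<u parent≤ =
  security-exchange-into-sibling-subtree T u₀ false y bw h≡ w₁<u parent≤
lemma2p6 T u₀ _ true bw _ _ h≡ (false ∷ y , refl) w₁<u parent≤ =
  security-exchange-into-sibling-subtree T u₀ true y bw h≡ w₁<u parent≤
lemma2p6 T u₀ _ false bw (_ , u-complete , _) (_ , _ , w-maximal) _ (false ∷ y , refl) _ _ =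
  ⊥-elim (w-maximal _ (∷ʳ-properAncestor u₀ false y bw) u-complete)
lemma2p6 T u₀ _ true bw (_ , u-complete , _) (_ , _ , w-maximal) _ (true ∷ y , refl) _ _ =
  ⊥-elim (w-maximal _ (∷ʳ-properAncestor u₀ true y bw) u-complete)
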